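{- Let $k\ge1$ and let $R\subseteq\underline k^2$ be preserved by $\mathrm{con}_k$. Let $a_1,a_2,b_1,b_2\in\underline k$ be such that $\{a_1,a_2\}\times\{b_1,b_2\}\subseteq R$. Then $R\cap([a_1,a_2]\times[b_1,b_2])$ is a (not necessarily spanning) biclique, i.e., equals $X\times Y$ for some $X\subseteq[a_1,a_2]$, $Y\subseteq[b_1,b_2]$.
   Context: $\underline k=\{0,\dots,k-1\}$ with natural order and $[a,b]=\{x: a\le x\le b\}$. A partial multivalued operation of arity $m$ on $D$ is $f:D^m\to2^D$ (empty = undefined); for a set $M$ of maps $D\to E$, $f_M(y_1,\dots,y_m)=\bigcup_{h\in M}\{h(z):z\in f(x_1,\dots,x_m),h(x_i)=y_i\ \forall i\}$; a multivalued $g$ on $E$ preserves $R\subseteq E^r$ if for all $t_1,\dots,t_m\in R$, every $u$ with $u[j]\in g(t_1[j],\dots,t_m[j])$ for all $j$ lies in $R$. The connector pattern $\mathsf{con}$ is the 5-ary operation on $\underline3$ with $\mathsf{con}(0,0,1,2,2)=\{0\}$, $\mathsf{con}(0,2,1,0,2)=\{1\}$, $\emptyset$ elsewhere, and $\mathrm{con}_k=\mathsf{con}_M$ for $M$ the set of all monotone or anti-monotone maps $\underline3\to\underline k$. -}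

module Defs where

open import Data.Nat using (ℕ)
open import Data.Fin using (Fin; zero; suc; _≤_)
open import Data.Product using (Σ; _×_)
open import Data.Sum using (_⊎_)
open import Relation.Binary.PropositionalEquality using (_≡_)

-- A partial multivalued operation f : D^m → 2^D, given by its membership
-- predicate:  MOp D m xs z  means  z ∈ f(xs).  (f(xs) = ∅ means undefined.)
MOp : Set → ℕ → Set₁
MOp D m = (Fin m → D) → D → Set

induced : {D E : Set} {m : ℕ} → ((D → E) → Set) → MOp D m → MOp E m
induced {D} {E} {m} M f ys w =
  Σ (D → E) λ h → M h × Σ (Fin m → D) λ xs → Σ D λ z →
    f xs z × ((i : Fin m) → h (xs i) ≡ ys i) × h z ≡ w

Preserves : {E : Set} {m r : ℕ} → MOp E m → ((Fin r → E) → Set) → Set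
Preserves {E} {m} {r} g R =
  (t : Fin m → Fin r → E) → ((i : Fin m) → R (t i)) →
  (u : Fin r → E) → ((j : Fin r) → g (λ i → t i j) (u j)) → R u

e0 e1 e2 : Fin 3
e0 = zero
e1 = suc zero
e2 = suc (suc zero)

tup5 : {A : Set} → A → A → A → A → A → Fin 5 → A
tup5 a b c d e zero = a
tup5 a b c d e (suc zero) = b
tup5 a b c d e (suc (suc zero)) = c
tup5 a b c d e (suc (suc (suc zero))) = d
tup5 a b c d e (suc (suc (suc (suc zero)))) = e

con : MOp (Fin 3) 5
con xs z =
  (((i : Fin 5) → xs i ≡ tup5 e0 e0 e1 e2 e2 i) × z ≡ e0)
  ⊎ (((i : Fin 5) → xs i ≡ tup5 e0 e2 e1 e0 e2 i) × z ≡ e1)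

Monotone : {k : ℕ} → (Fin 3 → Fin k) → Set
Monotone h = (x y : Fin 3) → x ≤ y → h x ≤ h y

AntiMonotone : {k : ℕ} → (Fin 3 → Fin k) → Set
AntiMonotone h = (x y : Fin 3) → x ≤ y → h y ≤ h x

MonAnti : (k : ℕ) → (Fin 3 → Fin k) → Set
MonAnti k h = Monotone h ⊎ AntiMonotone h

con[_] : (k : ℕ) → MOp (Fin k) 5
con[ k ] = induced (MonAnti k) con

_∈[_,_] : {k : ℕ} → Fin k → Fin k → Fin k → Set
x ∈[ a , b ] = (a ≤ x) × (x ≤ b)

asTuples : {k : ℕ} → (Fin k → Fin k → Set) → (Fin 2 → Fin k) → Set
asTuples R t = R (t zero) (t (suc zero))

{-# OPTIONS --safe #-}
-- Write S for R restricted to the box [a₁,a₂] × [b₁,b₂]. S is the product of its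
-- domain and codomain as soon as S x y′ and S x′ y imply S x y. Preservation by con_k
-- gives one closure rule: if R contains the corners of {p,r} × {s,v} and a point (q,y)
-- with q between p and r and y between s and v, then (p,y) ∈ R; since preservation is
-- stable under permuting coordinates, the rule also holds with the coordinates swapped.
-- Applied to the box corners and (x,y′), the swapped rule gives (x,b₁), (x,b₂) ∈ R;
-- the rule for the rectangle {x, aᵢ} × {b₁,b₂} containing (x′,y), with aᵢ the box
-- corner on the far side of x′, then gives (x,y) ∈ R.
module Submission where

open import Defs
open import Data.Nat using (ℕ; _≥_; s≤s)
open import Data.Fin using (Fin; zero; suc; _≤_)
open import Data.Fin.Properties using (≤-refl; ≤-trans; ≤-total)
open import Data.Product using (Σ; ∃; _×_; _,_; proj₁; proj₂)
open import Data.Sum using (_⊎_; inj₁; inj₂; swap)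
open import Data.Vec.Functional using ([]; _∷_)
open import Function using (_∘_; flip)
open import Function.Bundles using (_⇔_; mk⇔)
open import Level using (Level)
open import Relation.Binary.Core using (Rel)
open import Relation.Binary.Definitions using (Reflexive; Transitive)
open import Relation.Binary.PropositionalEquality using (_≡_; refl)

private
  variable
    ℓ ℓ′ : Level
    A B : Set

tup5-map : (h : A → B) (a b c d e : A) (i : Fin 5) →
           h (tup5 a b c d e i) ≡ tup5 (h a) (h b) (h c) (h d) (h e) i
tup5-map h a b c d e zero                         = refl
tup5-map h a b c d e (suc zero)                   = refl
tup5-map h a b c d e (suc (suc zero))             = refl
tup5-map h a b c d e (suc (suc (suc zero)))       = refl
tup5-map h a b c d e (suc (suc (suc (suc zero)))) = refl

path₃ : {C : Set ℓ} → C → C → C → Fin 3 → C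
path₃ p q r zero             = p
path₃ p q r (suc zero)       = q
path₃ p q r (suc (suc zero)) = r

path₃-mono : {C : Set ℓ} {_≼_ : Rel C ℓ′} → Reflexive _≼_ → Transitive _≼_ →
             ∀ {p q r} → p ≼ q → q ≼ r →
             (x y : Fin 3) → x ≤ y → path₃ p q r x ≼ path₃ p q r y
path₃-mono refl′ trans′ p≼q q≼r zero             zero             _ = refl′
path₃-mono refl′ trans′ p≼q q≼r zero             (suc zero)       _ = p≼q
path₃-mono refl′ trans′ p≼q q≼r zero             (suc (suc zero)) _ = trans′ p≼q q≼r
path₃-mono refl′ trans′ p≼q q≼r (suc zero)       (suc zero)       _ = refl′
path₃-mono refl′ trans′ p≼q q≼r (suc zero)       (suc (suc zero)) _ = q≼r
path₃-mono refl′ trans′ p≼q q≼r (suc (suc zero)) (suc (suc zero)) _ = refl′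
path₃-mono refl′ trans′ p≼q q≼r (suc (suc zero)) (suc zero)       (s≤s ())

Preserves-reindex : {E : Set} {m r r′ : ℕ} {g : MOp E m} {R : (Fin r → E) → Set} →
                    (σ : Fin r → Fin r′) → Preserves g R → Preserves g (λ u → R (u ∘ σ))
Preserves-reindex σ pres t t∈R u u∈g = pres (λ i → t i ∘ σ) t∈R (u ∘ σ) (u∈g ∘ σ)

Preserves-flip : {k m : ℕ} {g : MOp (Fin k) m} {R : Fin k → Fin k → Set} →
                 Preserves g (asTuples R) → Preserves g (asTuples (flip R))
Preserves-flip {g = g} {R} = Preserves-reindex {g = g} {asTuples R} (suc zero ∷ zero ∷ [])

Rectangular : (A → B → Set) → Set
Rectangular S = ∀ {x x′ y y′} → S x y′ → S x′ y → S x y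

Dom : (A → B → Set) → A → Set
Dom S x = ∃ (S x)

Cod : (A → B → Set) → B → Set
Cod S y = ∃ λ x → S x y

rectangular⇒product : {S : A → B → Set} → Rectangular S →
                      ∀ x y → S x y ⇔ (Dom S x × Cod S y)
rectangular⇒product rect x y =
  mk⇔ (λ s → (y , s) , (x , s)) (λ ((_ , sxy′) , (_ , sx′y)) → rect sxy′ sx′y)

module _ {k : ℕ} where

  Between : Fin k → Fin k → Fin k → Set
  Between p q r = (p ≤ q × q ≤ r) ⊎ (r ≤ q × q ≤ p)

  ∈[]⇒Between : ∀ {a b x} → x ∈[ a , b ] → Between a x b
  ∈[]⇒Between = inj₁

  Between-sym : ∀ {p q r} → Between p q r → Between r q p
  Between-sym = swap

  Between⇒MonAnti : ∀ {p q r} → Between p q r → MonAnti k (path₃ p q r)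
  Between⇒MonAnti (inj₁ (p≤q , q≤r)) =
    inj₁ (path₃-mono {_≼_ = _≤_} ≤-refl ≤-trans p≤q q≤r)
  Between⇒MonAnti (inj₂ (r≤q , q≤p)) =
    inj₂ (path₃-mono {_≼_ = flip _≤_} ≤-refl (flip ≤-trans) q≤p r≤q)

  con-outer : ∀ {p q r} → Between p q r → con[ k ] (tup5 p p q r r) p
  con-outer {p} {q} {r} pqr =
    path₃ p q r , Between⇒MonAnti pqr , tup5 e0 e0 e1 e2 e2 , e0 ,
    inj₁ ((λ _ → refl) , refl) , tup5-map (path₃ p q r) e0 e0 e1 e2 e2 , refl

  con-middle : ∀ {s y v} → Between s y v → con[ k ] (tup5 s v y s v) y
  con-middle {s} {y} {v} syv =
    path₃ s y v , Between⇒MonAnti syv , tup5 e0 e2 e1 e0 e2 , e1 ,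
    inj₂ ((λ _ → refl) , refl) , tup5-map (path₃ s y v) e0 e2 e1 e0 e2 , refl

  Restrict : (Fin k → Fin k → Set) → Fin k → Fin k → Fin k → Fin k → Fin k → Fin k → Set
  Restrict R a₁ a₂ b₁ b₂ x y = R x y × x ∈[ a₁ , a₂ ] × y ∈[ b₁ , b₂ ]

  project-onto-edge : {R : Fin k → Fin k → Set} → Preserves con[ k ] (asTuples R) →
    ∀ {p q r s v y} →
    R p s → R p v → R q y → R r s → R r v → Between p q r → Between s y v → R p y
  project-onto-edge {R} pres {p} {q} {r} {s} {v} {y} ps pv qy rs rv pqr syv =
    pres (flip columns) row∈R (p ∷ y ∷ [])
         λ { zero → con-outer pqr ; (suc zero) → con-middle syv }
    where
    columns : Fin 2 → Fin 5 → Fin k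
    columns = tup5 p p q r r ∷ tup5 s v y s v ∷ []

    row∈R : (i : Fin 5) → R (columns zero i) (columns (suc zero) i)
    row∈R zero                         = ps
    row∈R (suc zero)                   = pv
    row∈R (suc (suc zero))             = qy
    row∈R (suc (suc (suc zero)))       = rs
    row∈R (suc (suc (suc (suc zero)))) = rv

  Restrict-rectangular : {R : Fin k → Fin k → Set} → Preserves con[ k ] (asTuples R) →
    ∀ {a₁ a₂ b₁ b₂} → R a₁ b₁ → R a₁ b₂ → R a₂ b₁ → R a₂ b₂ →
    Rectangular (Restrict R a₁ a₂ b₁ b₂)
  Restrict-rectangular {R} pres {a₁} {a₂} {b₁} {b₂} c₁₁ c₁₂ c₂₁ c₂₂
                       {x} {x′} {y} {y′} (xy′ , x∈ , y′∈) (x′y , x′∈ , y∈) =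
    xy (≤-total x x′) , x∈ , y∈
    where
    pres-flip : Preserves con[ k ] (asTuples (flip R))
    pres-flip = Preserves-flip {g = con[ k ]} {R = R} pres

    xb₁ : R x b₁
    xb₁ = project-onto-edge pres-flip c₁₁ c₂₁ xy′ c₁₂ c₂₂
                            (∈[]⇒Between y′∈) (∈[]⇒Between x∈)

    xb₂ : R x b₂
    xb₂ = project-onto-edge pres-flip c₁₂ c₂₂ xy′ c₁₁ c₂₁
                            (Between-sym (∈[]⇒Between y′∈)) (∈[]⇒Between x∈)

    xy : (x ≤ x′) ⊎ (x′ ≤ x) → R x y
    xy (inj₁ x≤x′) =
      project-onto-edge pres xb₁ xb₂ x′y c₂₁ c₂₂ (inj₁ (x≤x′ , proj₂ x′∈)) (∈[]⇒Between y∈)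
    xy (inj₂ x′≤x) =
      project-onto-edge pres xb₁ xb₂ x′y c₁₁ c₁₂ (inj₂ (proj₁ x′∈ , x′≤x)) (∈[]⇒Between y∈)

mainTheorem16 : (k : ℕ) → k ≥ 1 → (R : Fin k → Fin k → Set) →
    Preserves con[ k ] (asTuples R) →
    (a₁ a₂ b₁ b₂ : Fin k) →
    R a₁ b₁ → R a₁ b₂ → R a₂ b₁ → R a₂ b₂ →
    Σ (Fin k → Set) λ X → Σ (Fin k → Set) λ Y →
      ((x : Fin k) → X x → x ∈[ a₁ , a₂ ]) ×
      ((y : Fin k) → Y y → y ∈[ b₁ , b₂ ]) ×
      ((x y : Fin k) → ((R x y × x ∈[ a₁ , a₂ ] × y ∈[ b₁ , b₂ ]) ⇔ (X x × Y y)))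
mainTheorem16 k _ R pres a₁ a₂ b₁ b₂ c₁₁ c₁₂ c₂₁ c₂₂ =
  Dom S , Cod S ,
  (λ _ (_ , _ , x∈ , _) → x∈) ,
  (λ _ (_ , _ , _ , y∈) → y∈) ,
  rectangular⇒product (Restrict-rectangular pres c₁₁ c₁₂ c₂₁ c₂₂)
  where
  S : Fin k → Fin k → Set
  S = Restrict R a₁ a₂ b₁ b₂
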